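{- Let $\ell$ be an odd prime, $q=p^n$ a prime power, $k=\frac{q^\ell-1}{q-1}$, and $0\le a,b\le q-2$. Then $0\le\#I_\ell(a,b)\le q^{\ell-2}$.
   Context: $\omega$ is a fixed generator of $\mathbb{F}_{q^\ell}^\times$. $I_\ell(a,b):=\{m_x(X)\in\mathbb{F}_q[X]\mid x\in\bar{\mathbb{F}}_q,\ [\mathbb{F}_q(x):\mathbb{F}_q]=\ell,\ m_x(0)=-\omega^{ak},\ m_x(-1)=-\omega^{bk}\}$, where $m_x$ is the minimal polynomial of $x$ over $\mathbb{F}_q$. -}

module Defs where

open import Data.Nat as ℕ using (ℕ; zero; suc; _∸_; _≤_)
open import Data.Nat.DivMod using (_/_)
open import Data.Fin using (Fin)
open import Data.List using (List; []; _∷_; length)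
open import Data.List.Relation.Unary.All using (All)
open import Data.Product using (Σ; ∃; _×_)
open import Relation.Binary.PropositionalEquality using (_≡_)
open import Relation.Nullary using (¬_)
open import Algebra.Structures using (IsCommutativeRing)
open import Function.Bundles using (_↔_)

record Field : Set₁ where
  infixl 6 _+_
  infixl 7 _*_
  field
    Carrier : Set
    _+_ _*_ : Carrier → Carrier → Carrier
    -_      : Carrier → Carrier
    0# 1#   : Carrier
    isCommutativeRing : IsCommutativeRing _≡_ _+_ _*_ -_ 0# 1#
    0≢1     : ¬ (0# ≡ 1#)
    inverse : ∀ x → ¬ (x ≡ 0#) → Σ Carrier λ y → x * y ≡ 1#

module _ (K : Field) where
  open Field K

  pow : Carrier → ℕ → Carrier
  pow x zero    = 1#
  pow x (suc n) = x * pow x n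

  HasCard : ℕ → Set
  HasCard N = Carrier ↔ Fin N

  IsGenerator : Carrier → Set
  IsGenerator ω = ∀ y → ¬ (y ≡ 0#) → ∃ λ i → pow ω i ≡ y

  -- The subfield F_q = { c ∈ K | c^q = c } (for |K| = q^ℓ).
  InFq : ℕ → Carrier → Set
  InFq q c = pow c q ≡ c

  -- Polynomials: coefficient lists, lowest degree first.
  Poly : Set
  Poly = List Carrier

  eval : Poly → Carrier → Carrier
  eval []       x = 0#
  eval (c ∷ cs) x = c + x * eval cs x

  Monic : Poly → Set
  Monic []           = Data.Empty.⊥ where import Data.Empty
  Monic (c ∷ [])     = c ≡ 1#
  Monic (c ∷ d ∷ cs) = Monic (d ∷ cs)

  OverFq : ℕ → Poly → Set
  OverFq q f = All (InFq q) f

  deg : Poly → ℕ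
  deg f = length f ∸ 1

  IsMinPoly : ℕ → Carrier → Poly → Set
  IsMinPoly q x f =
    OverFq q f × Monic f × eval f x ≡ 0# ×
    (∀ g → OverFq q g → Monic g → eval g x ≡ 0# → deg f ≤ deg g)

  -- Membership in I_ℓ(a,b): f = m_x for some x with [F_q(x):F_q] = ℓ,
  -- m_x(0) = -ω^{ak}, m_x(-1) = -ω^{bk}.
  -- (Every x of degree ℓ over F_q lies in F_{q^ℓ} = K.)
  InI : (q ℓ k a b : ℕ) (ω : Carrier) → Poly → Set
  InI q ℓ k a b ω f =
    ∃ λ (x : Carrier) → IsMinPoly q x f × deg f ≡ ℓ ×
      eval f 0# ≡ - pow ω (a ℕ.* k) ×
      eval f (- 1#) ≡ - pow ω (b ℕ.* k)

kOf : ℕ → ℕ → ℕ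
kOf zero          ℓ = 0
kOf (suc zero)    ℓ = 0
kOf (suc (suc r)) ℓ = (suc (suc r) ℕ.^ ℓ ∸ 1) / suc r

-- The value f(0) is the constant coefficient, and once the other coefficients are
-- fixed, f(-1) determines the linear one. Hence f is determined by its ℓ - 2 coefficients of
-- X², …, X^(ℓ-1), each of which lies in F_q, and F_q has at most q elements because they are
-- roots of X^q - X. Neither the oddness of ℓ nor the choice of ω, a and b plays a role.
module Submission where

open import Defs
open import Data.Nat using (ℕ; _≤_; _∸_; _^_; _≥_)
open import Data.Nat.Primality using (Prime)
open import Data.Nat.DivMod using (_%_)
open import Relation.Binary.PropositionalEquality using (_≡_)
open import Data.List using (List; length)
open import Data.List.Relation.Unary.All using (All)
open import Data.List.Relation.Unary.Unique.Propositional using (Unique)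

open import Data.Nat as ℕ using (zero; suc; z≤n; s≤s; _≤?_; nonTrivial⇒n>1)
import Data.Nat.Properties as ℕ
open import Data.Nat.Primality using (prime⇒nonTrivial)
import Data.Fin as Fin
open import Data.List using ([]; _∷_; [_]; _++_; map; filter; take; drop; allFin; cartesianProductWith)
import Data.List.Properties as List
open import Data.List.Relation.Unary.All as All using ([]; _∷_)
open import Data.List.Relation.Unary.All.Properties using (all-filter; take⁺; drop⁺)
open import Data.List.Relation.Unary.AllPairs using (_∷_)
open import Data.List.Relation.Unary.Any using (here; there)
import Data.List.Relation.Unary.Any.Properties as Any
open import Data.List.Membership.Propositional using (_∈_)
open import Data.List.Membership.Propositional.Properties using (∈-∃++; ∈-map⁺; ∈-allFin; ∈-filter⁺)
import Data.List.Relation.Unary.Unique.Propositional.Properties as Unique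
open import Data.Product using (_,_; proj₁; proj₂)
open import Data.Empty using (⊥-elim)
open import Data.Maybe using (nothing)
open import Relation.Nullary using (¬_; yes; no)
open import Relation.Nullary.Decidable using (via-injection)
open import Relation.Binary.PropositionalEquality
  using (refl; sym; trans; cong; cong₂; subst; _≢_; module ≡-Reasoning)
open import Relation.Binary.Definitions using (DecidableEquality)
open import Algebra.Bundles using (CommutativeRing)
import Algebra.Properties.Ring as RingProperties
open import Function.Bundles using (Inverse)
open import Function.Properties.Inverse using (↔⇒↣)
open import Tactic.RingSolver.Core.AlmostCommutativeRing using (fromCommutativeRing)
import Tactic.RingSolver.NonReflective as Solver

∈-++-∷-skip : ∀ {A : Set} {x y : A} ys zs → y ∈ ys ++ x ∷ zs → y ≢ x → y ∈ ys ++ zs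
∈-++-∷-skip []       zs (here y≡x) y≢x = ⊥-elim (y≢x y≡x)
∈-++-∷-skip []       zs (there y∈) y≢x = y∈
∈-++-∷-skip (w ∷ ys) zs (here y≡w) y≢x = here y≡w
∈-++-∷-skip (w ∷ ys) zs (there y∈) y≢x = there (∈-++-∷-skip ys zs y∈ y≢x)

length-≤-of-injection : ∀ {A B : Set} (enc : A → B) {xs : List A} {ys : List B} → Unique xs →
  (∀ {x y} → x ∈ xs → y ∈ xs → enc x ≡ enc y → x ≡ y) →
  (∀ {x} → x ∈ xs → enc x ∈ ys) →
  length xs ≤ length ys
length-≤-of-injection enc {[]}     _            _   _    = z≤n
length-≤-of-injection enc {x ∷ xs} (x∉xs ∷ xs!) inj into
  with ys₁ , ys₂ , refl ← ∈-∃++ (into (here refl)) = begin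
    suc (length xs)                    ≤⟨ s≤s (length-≤-of-injection enc xs! inj′ into′) ⟩
    suc (length (ys₁ ++ ys₂))          ≡⟨ cong suc (List.length-++ ys₁) ⟩
    suc (length ys₁ ℕ.+ length ys₂)    ≡⟨ ℕ.+-suc (length ys₁) (length ys₂) ⟨
    length ys₁ ℕ.+ suc (length ys₂)    ≡⟨ List.length-++ ys₁ ⟨
    length (ys₁ ++ enc x ∷ ys₂)        ∎
  where
  open ℕ.≤-Reasoning
  inj′ : ∀ {y z} → y ∈ xs → z ∈ xs → enc y ≡ enc z → y ≡ z
  inj′ y∈ z∈ = inj (there y∈) (there z∈)
  into′ : ∀ {y} → y ∈ xs → enc y ∈ ys₁ ++ ys₂
  into′ y∈ = ∈-++-∷-skip ys₁ ys₂ (into (there y∈))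
    (λ e → All.lookup x∉xs y∈ (sym (inj (there y∈) (here refl) e)))

length-cartesianProductWith : ∀ {A B C : Set} (f : A → B → C) xs ys →
  length (cartesianProductWith f xs ys) ≡ length xs ℕ.* length ys
length-cartesianProductWith f []       ys = refl
length-cartesianProductWith f (x ∷ xs) ys = begin
  length (map (f x) ys ++ cartesianProductWith f xs ys)                 ≡⟨ List.length-++ (map (f x) ys) ⟩
  length (map (f x) ys) ℕ.+ length (cartesianProductWith f xs ys)
    ≡⟨ cong₂ ℕ._+_ (List.length-map (f x) ys) (length-cartesianProductWith f xs ys) ⟩
  length ys ℕ.+ length xs ℕ.* length ys                                 ∎
  where open ≡-Reasoning

module _ {A : Set} where

  words : List A → ℕ → List (List A)
  words xs zero    = [ [] ]
  words xs (suc n) = cartesianProductWith _∷_ xs (words xs n)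

  length-words : ∀ xs n → length (words xs n) ≡ length xs ^ n
  length-words xs zero    = refl
  length-words xs (suc n) =
    trans (length-cartesianProductWith _∷_ xs (words xs n)) (cong (length xs ℕ.*_) (length-words xs n))

  ∈-words : ∀ {xs ys n} → All (_∈ xs) ys → length ys ≡ n → ys ∈ words xs n
  ∈-words []               refl = here refl
  ∈-words (y∈xs ∷ ys⊆xs) refl = Any.cartesianProductWith⁺ _∷_ (cong₂ _∷_) y∈xs (∈-words ys⊆xs refl)

module Polynomial (K : Field) where
  open Field K

  commutativeRing : CommutativeRing _ _
  commutativeRing = record { isCommutativeRing = isCommutativeRing }

  open CommutativeRing commutativeRing
    using (_-_; +-identityˡ; +-identityʳ; -‿inverseˡ; zeroˡ; zeroʳ; *-identityˡ; *-identityʳ; *-assoc; *-comm; distribˡ; ring)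
  open RingProperties ring
    using (+-cancelˡ; +-cancelʳ; -‿involutive; -0#≈0#; -‿distribʳ-*; //-rightDividesˡ; x∙y⁻¹≈ε⇒x≈y)
  open Solver (fromCommutativeRing commutativeRing (λ _ → nothing)) using (solve; _⊜_; _⊕_; _⊗_)
  open import Algebra.Definitions {A = Carrier} _≡_ using (AlmostLeftCancellative)
  open ≡-Reasoning

  *-cancelˡ-≢0 : AlmostLeftCancellative 0# _*_
  *-cancelˡ-≢0 a b c a≢0 ab≡ac with a⁻¹ , aa⁻¹≡1 ← inverse a a≢0 = begin
    b              ≡⟨ *-identityˡ b ⟨
    1# * b         ≡⟨ cong (_* b) (trans (sym aa⁻¹≡1) (*-comm a a⁻¹)) ⟩
    a⁻¹ * a * b    ≡⟨ *-assoc a⁻¹ a b ⟩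
    a⁻¹ * (a * b)  ≡⟨ cong (a⁻¹ *_) ab≡ac ⟩
    a⁻¹ * (a * c)  ≡⟨ *-assoc a⁻¹ a c ⟨
    a⁻¹ * a * c    ≡⟨ cong (_* c) (trans (*-comm a⁻¹ a) aa⁻¹≡1) ⟩
    1# * c         ≡⟨ *-identityˡ c ⟩
    c              ∎

  -1≢0 : - 1# ≢ 0#
  -1≢0 -1≡0 = 0≢1 (sym (trans (sym (-‿involutive 1#)) (trans (cong -_ -1≡0) -0#≈0#)))

  IsRoot : Poly K → Carrier → Set
  IsRoot p r = eval K p r ≡ 0#

  IsZero : Poly K → Set
  IsZero = All (_≡ 0#)

  eval-∷-0# : ∀ c cs → eval K (c ∷ cs) 0# ≡ c
  eval-∷-0# c cs = trans (cong (c +_) (zeroˡ _)) (+-identityʳ c)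

  eval-∷-root : ∀ c cs {r} → IsRoot cs r → eval K (c ∷ cs) r ≡ c
  eval-∷-root c cs {r} cs[r]≡0 = trans (cong (λ v → c + r * v) cs[r]≡0) (trans (cong (c +_) (zeroʳ r)) (+-identityʳ c))

  -- Synthetic (Horner) division of p by X - r; the remainder is p(r).
  quotientByLinear : Carrier → Poly K → Poly K
  quotientByLinear r []                = []
  quotientByLinear r (c ∷ [])          = []
  quotientByLinear r (c ∷ cs@(_ ∷ _)) = eval K cs r ∷ quotientByLinear r cs

  length-quotientByLinear : ∀ r p → length (quotientByLinear r p) ≡ length p ∸ 1
  length-quotientByLinear r []                = refl
  length-quotientByLinear r (c ∷ [])          = refl
  length-quotientByLinear r (c ∷ cs@(_ ∷ _)) = cong suc (length-quotientByLinear r cs)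

  -- Stated at the point t + r rather than x with t = x - r, so that the inductive step is a
  -- negation-free identity the ring solver can normalise.
  eval-quotientByLinear : ∀ r p t →
    eval K p (t + r) ≡ eval K p r + t * eval K (quotientByLinear r p) (t + r)
  eval-quotientByLinear r [] t = sym (trans (+-identityˡ _) (zeroʳ t))
  eval-quotientByLinear r (c ∷ []) t = begin
    c + (t + r) * 0#         ≡⟨ cong (c +_) (zeroʳ (t + r)) ⟩
    c + 0#                   ≡⟨ cong (c +_) (zeroʳ r) ⟨
    c + r * 0#               ≡⟨ +-identityʳ _ ⟨
    c + r * 0# + 0#          ≡⟨ cong (c + r * 0# +_) (zeroʳ t) ⟨
    c + r * 0# + t * 0#      ∎
  eval-quotientByLinear r (c ∷ cs@(_ ∷ _)) t = begin
    c + (t + r) * eval K cs (t + r)       ≡⟨ cong (λ v → c + (t + r) * v) (eval-quotientByLinear r cs t) ⟩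
    c + (t + r) * (E + t * D)             ≡⟨ horner c t r E D ⟩
    (c + r * E) + t * (E + (t + r) * D)   ∎
    where
    E = eval K cs r
    D = eval K (quotientByLinear r cs) (t + r)
    horner : ∀ c t r E D → c + (t + r) * (E + t * D) ≡ (c + r * E) + t * (E + (t + r) * D)
    horner = solve 5 (λ c t r E D → (c ⊕ (t ⊕ r) ⊗ (E ⊕ t ⊗ D)) ⊜ ((c ⊕ r ⊗ E) ⊕ t ⊗ (E ⊕ (t ⊕ r) ⊗ D))) refl

  quotientByLinear-root : ∀ p {r s} → IsRoot p r → IsRoot p s → s ≢ r → IsRoot (quotientByLinear r p) s
  quotientByLinear-root p {r} {s} p[r]≡0 p[s]≡0 s≢r =
    *-cancelˡ-≢0 (s - r) _ 0# (λ s-r≡0 → s≢r (x∙y⁻¹≈ε⇒x≈y s r s-r≡0)) (begin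
      (s - r) * eval K q s                          ≡⟨ cong (λ x → (s - r) * eval K q x) (//-rightDividesˡ r s) ⟨
      (s - r) * eval K q (s - r + r)                ≡⟨ +-identityˡ _ ⟨
      0# + (s - r) * eval K q (s - r + r)           ≡⟨ cong (λ v → v + (s - r) * eval K q (s - r + r)) p[r]≡0 ⟨
      eval K p r + (s - r) * eval K q (s - r + r)   ≡⟨ eval-quotientByLinear r p (s - r) ⟨
      eval K p (s - r + r)                          ≡⟨ cong (eval K p) (//-rightDividesˡ r s) ⟩
      eval K p s                                    ≡⟨ p[s]≡0 ⟩
      0#                                            ≡⟨ zeroʳ (s - r) ⟨
      (s - r) * 0#                                  ∎)
    where q = quotientByLinear r p

  IsZero-quotientByLinear⁻ : ∀ {r} p → IsRoot p r → IsZero (quotientByLinear r p) → IsZero p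
  IsZero-quotientByLinear⁻ []                p[r]≡0 _                 = []
  IsZero-quotientByLinear⁻ (c ∷ [])          p[r]≡0 _                 = trans (sym (eval-∷-root c [] refl)) p[r]≡0 ∷ []
  IsZero-quotientByLinear⁻ (c ∷ cs@(_ ∷ _)) p[r]≡0 (cs[r]≡0 ∷ q≡0) =
    trans (sym (eval-∷-root c cs cs[r]≡0)) p[r]≡0 ∷ IsZero-quotientByLinear⁻ cs cs[r]≡0 q≡0

  IsZero-of-roots : ∀ {rs} p → Unique rs → All (IsRoot p) rs → length p ≤ length rs → IsZero p
  IsZero-of-roots {[]}     []      _             _                 _     = []
  IsZero-of-roots {r ∷ rs} p (r∉rs ∷ rs!) (p[r]≡0 ∷ p[rs]≡0) |p|≤ =
    IsZero-quotientByLinear⁻ p p[r]≡0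
      (IsZero-of-roots (quotientByLinear r p) rs! (roots-of-quotient rs r∉rs p[rs]≡0) |q|≤)
    where
    |q|≤ : length (quotientByLinear r p) ≤ length rs
    |q|≤ = ℕ.≤-trans (ℕ.≤-reflexive (length-quotientByLinear r p)) (ℕ.∸-monoˡ-≤ 1 |p|≤)
    roots-of-quotient : ∀ ss → All (r ≢_) ss → All (IsRoot p) ss → All (IsRoot (quotientByLinear r p)) ss
    roots-of-quotient []       []             []                  = []
    roots-of-quotient (s ∷ ss) (r≢s ∷ r≢ss) (p[s]≡0 ∷ p[ss]≡0) =
      quotientByLinear-root p p[r]≡0 p[s]≡0 (λ s≡r → r≢s (sym s≡r)) ∷ roots-of-quotient ss r≢ss p[ss]≡0

  monomial : ℕ → Poly K
  monomial zero    = [ 1# ]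
  monomial (suc m) = 0# ∷ monomial m

  eval-monomial : ∀ m x → eval K (monomial m) x ≡ pow K x m
  eval-monomial zero    x = eval-∷-root 1# [] refl
  eval-monomial (suc m) x = trans (+-identityˡ _) (cong (x *_) (eval-monomial m x))

  length-monomial : ∀ m → length (monomial m) ≡ suc m
  length-monomial zero    = refl
  length-monomial (suc m) = cong suc (length-monomial m)

  ¬IsZero-monomial : ∀ m → ¬ IsZero (monomial m)
  ¬IsZero-monomial zero    (1≡0 ∷ []) = 0≢1 (sym 1≡0)
  ¬IsZero-monomial (suc m) (_ ∷ z)    = ¬IsZero-monomial m z

  frobeniusPoly : ℕ → Poly K
  frobeniusPoly m = 0# ∷ - 1# ∷ monomial m

  frobeniusPoly-root : ∀ m {x} → InFq K (suc (suc m)) x → IsRoot (frobeniusPoly m) x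
  frobeniusPoly-root m {x} x^q≡x = begin
    0# + x * (- 1# + x * eval K (monomial m) x)  ≡⟨ +-identityˡ _ ⟩
    x * (- 1# + x * eval K (monomial m) x)       ≡⟨ distribˡ x (- 1#) _ ⟩
    x * - 1# + x * (x * eval K (monomial m) x)   ≡⟨ cong (λ v → x * - 1# + x * (x * v)) (eval-monomial m x) ⟩
    x * - 1# + pow K x (suc (suc m))             ≡⟨ cong₂ _+_ (-‿distribʳ-* x 1#) (sym x^q≡x) ⟨
    - (x * 1#) + x                               ≡⟨ cong (λ v → - v + x) (*-identityʳ x) ⟩
    - x + x                                      ≡⟨ -‿inverseˡ x ⟩
    0#                                           ∎

  Unique-InFq⇒length≤ : ∀ m {rs} → Unique rs → All (InFq K (suc (suc m))) rs → length rs ≤ suc (suc m)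
  Unique-InFq⇒length≤ m {rs} rs! rs⊆Fq with length rs ≤? suc (suc m)
  ... | yes |rs|≤q = |rs|≤q
  ... | no  |rs|≰q = ⊥-elim (¬IsZero-monomial m (drop⁺ 2 frobeniusPoly≡0))
    where
    frobeniusPoly≡0 : IsZero (frobeniusPoly m)
    frobeniusPoly≡0 = IsZero-of-roots (frobeniusPoly m) rs! (All.map (frobeniusPoly-root m) rs⊆Fq)
      (ℕ.≤-trans (ℕ.≤-reflexive (cong (ℕ._+_ 2) (length-monomial m))) (ℕ.≰⇒> |rs|≰q))

  linearCoefficient-unique : ∀ {x} c c₁ d₁ cs → x ≢ 0# →
    eval K (c ∷ c₁ ∷ cs) x ≡ eval K (c ∷ d₁ ∷ cs) x → c₁ ≡ d₁
  linearCoefficient-unique {x} c c₁ d₁ cs x≢0 f[x]≡g[x] =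
    +-cancelʳ (x * eval K cs x) c₁ d₁ (*-cancelˡ-≢0 x _ _ x≢0 (+-cancelˡ c _ _ f[x]≡g[x]))

  Monic-take-injective : ∀ m {f g} → length f ≡ suc m → length g ≡ suc m → Monic K f → Monic K g →
    take m f ≡ take m g → f ≡ g
  Monic-take-injective zero    {c ∷ []}         {d ∷ []}         _ _ c≡1 d≡1 _ = cong [_] (trans c≡1 (sym d≡1))
  Monic-take-injective (suc m) {c ∷ f@(_ ∷ _)} {d ∷ g@(_ ∷ _)} |f| |g| f-monic g-monic f≡g =
    cong₂ _∷_ (proj₁ (List.∷-injective f≡g))
      (Monic-take-injective m (ℕ.suc-injective |f|) (ℕ.suc-injective |g|) f-monic g-monic
        (proj₂ (List.∷-injective f≡g)))

  middleCoefficients : ℕ → Poly K → List Carrier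
  middleCoefficients L f = take L (drop 2 f)

  monic-≡ : ∀ L {x} → x ≢ 0# → ∀ {f g} → deg K f ≡ suc (suc L) → deg K g ≡ suc (suc L) →
    Monic K f → Monic K g → eval K f 0# ≡ eval K g 0# → eval K f x ≡ eval K g x →
    middleCoefficients L f ≡ middleCoefficients L g → f ≡ g
  monic-≡ L x≢0 {c ∷ c₁ ∷ f@(_ ∷ _)} {d ∷ d₁ ∷ g@(_ ∷ _)} |f| |g| f-monic g-monic f[0]≡g[0] f[x]≡g[x] mid
    with refl ← trans (sym (eval-∷-0# c (c₁ ∷ f))) (trans f[0]≡g[0] (eval-∷-0# d (d₁ ∷ g)))
       | refl ← Monic-take-injective L (ℕ.suc-injective |f|) (ℕ.suc-injective |g|) f-monic g-monic mid
    = cong (λ c₁ → c ∷ c₁ ∷ f) (linearCoefficient-unique c c₁ d₁ f x≢0 f[x]≡g[x])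

  length-middleCoefficients : ∀ L {f} → deg K f ≡ suc (suc L) → length (middleCoefficients L f) ≡ L
  length-middleCoefficients L {_ ∷ _ ∷ f} |f| =
    trans (List.length-take L f) (ℕ.m≤n⇒m⊓n≡m (ℕ.≤-trans (ℕ.n≤1+n L) (ℕ.≤-reflexive (sym (ℕ.suc-injective |f|)))))

  InI-middleCoefficients-injective : ∀ q L k a b ω {f g} →
    InI K q (suc (suc L)) k a b ω f → InI K q (suc (suc L)) k a b ω g →
    middleCoefficients L f ≡ middleCoefficients L g → f ≡ g
  InI-middleCoefficients-injective q L k a b ω
    (_ , (_ , f-monic , _) , |f| , f[0] , f[-1]) (_ , (_ , g-monic , _) , |g| , g[0] , g[-1]) =
    monic-≡ L -1≢0 |f| |g| f-monic g-monic (trans f[0] (sym g[0])) (trans f[-1] (sym g[-1]))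

module FiniteField (K : Field) {N} (card : HasCard K N) where
  open Field K
  open Inverse card using (to; from; strictlyInverseʳ; strictlyInverseˡ)
  open Polynomial K

  elements : List Carrier
  elements = map from (allFin N)

  ∈-elements : ∀ x → x ∈ elements
  ∈-elements x = subst (_∈ elements) (strictlyInverseʳ x) (∈-map⁺ from (∈-allFin (to x)))

  elements! : Unique elements
  elements! = Unique.map⁺ from-injective (Unique.allFin⁺ N)
    where
    from-injective : ∀ {i j} → from i ≡ from j → i ≡ j
    from-injective {i} {j} e = trans (sym (strictlyInverseˡ i)) (trans (cong to e) (strictlyInverseˡ j))

  _≟_ : DecidableEquality Carrier
  _≟_ = via-injection (↔⇒↣ card) Fin._≟_

  subfield : ℕ → List Carrier
  subfield q = filter (λ c → pow K c q ≟ c) elements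

  ∈-subfield : ∀ {q c} → InFq K q c → c ∈ subfield q
  ∈-subfield {q} {c} = ∈-filter⁺ (λ c → pow K c q ≟ c) (∈-elements c)

  length-subfield≤ : ∀ m → length (subfield (suc (suc m))) ≤ suc (suc m)
  length-subfield≤ m =
    Unique-InFq⇒length≤ m (Unique.filter⁺ _ elements!) (all-filter (λ c → pow K c (suc (suc m)) ≟ c) elements)

  length-InI≤ : ∀ q ℓ k a b ω {fs} → 2 ≤ q → 2 ≤ ℓ →
    Unique fs → All (InI K q ℓ k a b ω) fs → length fs ≤ q ^ (ℓ ∸ 2)
  length-InI≤ q@(suc (suc m)) (suc (suc L)) k a b ω {fs} (s≤s (s≤s _)) (s≤s (s≤s _)) fs! fs⊆I = begin
    length fs                      ≤⟨ length-≤-of-injection (middleCoefficients L) fs! injective into ⟩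
    length (words (subfield q) L)  ≡⟨ length-words (subfield q) L ⟩
    length (subfield q) ^ L        ≤⟨ ℕ.^-monoˡ-≤ L (length-subfield≤ m) ⟩
    q ^ L                          ∎
    where
    open ℕ.≤-Reasoning
    injective : ∀ {f g} → f ∈ fs → g ∈ fs → middleCoefficients L f ≡ middleCoefficients L g → f ≡ g
    injective f∈fs g∈fs = InI-middleCoefficients-injective q L k a b ω (All.lookup fs⊆I f∈fs) (All.lookup fs⊆I g∈fs)
    into : ∀ {f} → f ∈ fs → middleCoefficients L f ∈ words (subfield q) L
    into {f} f∈fs with _ , (f⊆Fq , _) , |f| , _ ← All.lookup fs⊆I f∈fs =
      ∈-words (All.map (∈-subfield {q}) (take⁺ L (drop⁺ 2 f⊆Fq))) (length-middleCoefficients L {f} |f|)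

prime⇒2≤ : ∀ {p} → Prime p → 2 ≤ p
prime⇒2≤ {p} p-prime = nonTrivial⇒n>1 p {{prime⇒nonTrivial p-prime}}

proposition5p3 : (ℓ p n q a b : ℕ) → Prime ℓ → ℓ % 2 ≡ 1 → Prime p → n ≥ 1 → q ≡ p ^ n →
    (K : Field) → HasCard K (q ^ ℓ) → (ω : Field.Carrier K) → IsGenerator K ω →
    a ≤ q ∸ 2 → b ≤ q ∸ 2 →
    (fs : List (Poly K)) → Unique fs → All (InI K q ℓ (kOf q ℓ) a b ω) fs →
    length fs ≤ q ^ (ℓ ∸ 2)
proposition5p3 ℓ p n _ a b ℓ-prime _ p-prime n≥1 refl K card ω _ _ _ fs fs! fs⊆I =
  FiniteField.length-InI≤ K card (p ^ n) ℓ (kOf (p ^ n) ℓ) a b ω 2≤q (prime⇒2≤ ℓ-prime) fs! fs⊆I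
  where
  2≤q : 2 ≤ p ^ n
  2≤q = ℕ.^-monoʳ-< p (prime⇒2≤ p-prime) n≥1
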